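{- For a signed graph $\Sigma$, $Q(\Sigma)=1$ if and only if $\Sigma$ has a cycle with exactly one negative edge and there is an edge common to all cycles of $\Sigma$ that have exactly one negative edge.
   Context: A signed graph $\Sigma=(\Gamma,\sigma)$ has $\sigma:E\to\{+,-\}$. $\Sigma$ is clusterable if its vertex set can be partitioned into sets (clusters) so that every edge within a cluster is positive and every edge between two clusters is negative. The inclusterability index $Q(\Sigma)$ is the smallest number of edges whose deletion leaves a clusterable signed graph. (Known fact, Davis: a signed graph is clusterable iff no cycle has exactly one negative edge.) -}

module Defs where

open import Data.Nat as ℕ using (ℕ; zero; suc; s≤s; _<_)
open import Data.Nat.Properties using (_<?_)
open import Data.Fin using (Fin; toℕ; fromℕ<)
open import Data.Fin.Subset using (Subset; _∈_; _∉_; ∣_∣)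
open import Data.Product using (_×_; _,_; Σ; ∃; ∃-syntax; proj₁; proj₂)
open import Data.Sum using (_⊎_)
open import Relation.Binary.PropositionalEquality using (_≡_; _≢_)
open import Relation.Nullary using (¬_; yes; no)
open import Function.Definitions using (Injective)

data Sign : Set where
  pos neg : Sign

record SignedGraph : Set where
  field
    n        : ℕ
    m        : ℕ
    ends     : Fin m → Fin n × Fin n
    sign     : Fin m → Sign
open SignedGraph public

Joins : (Σ' : SignedGraph) → Fin (m Σ') → Fin (n Σ') → Fin (n Σ') → Set
Joins Σ' e a b = ends Σ' e ≡ (a , b) ⊎ ends Σ' e ≡ (b , a)

next : ∀ {k} → Fin (suc k) → Fin (suc k)
next {k} i with toℕ i <? k
... | yes p = fromℕ< (s≤s p)
... | no _  = Fin.zero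

record Cycle (Σ' : SignedGraph) : Set where
  field
    len   : ℕ
    vtx   : Fin (suc len) → Fin (n Σ')
    edg   : Fin (suc len) → Fin (m Σ')
    vtx-inj : Injective _≡_ _≡_ vtx
    edg-inj : Injective _≡_ _≡_ edg
    joins : ∀ i → Joins Σ' (edg i) (vtx i) (vtx (next i))
open Cycle public

OnCycle : {Σ' : SignedGraph} → Fin (m Σ') → Cycle Σ' → Set
OnCycle e C = ∃[ i ] edg C i ≡ e

ExactlyOneNegative : {Σ' : SignedGraph} → Cycle Σ' → Set
ExactlyOneNegative {Σ'} C =
  ∃[ i ] (sign Σ' (edg C i) ≡ neg × (∀ j → j ≢ i → sign Σ' (edg C j) ≡ pos))

ClusterableMinus : (Σ' : SignedGraph) → Subset (m Σ') → Set
ClusterableMinus Σ' S =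
  Σ (Fin (n Σ') → ℕ) λ c → (∀ (e : Fin (m Σ')) → e ∉ S →
    ((c (proj₁ (ends Σ' e)) ≡ c (proj₂ (ends Σ' e)) → sign Σ' e ≡ pos) ×
     (c (proj₁ (ends Σ' e)) ≢ c (proj₂ (ends Σ' e)) → sign Σ' e ≡ neg)))

-- Q(Σ') ≡ q, i.e. q is the least number of edges whose deletion
-- leaves a clusterable signed graph.
InclusterabilityIndexIs : SignedGraph → ℕ → Set
InclusterabilityIndexIs Σ' q =
  (∃[ S ] (∣ S ∣ ≡ q × ClusterableMinus Σ' S)) ×
  (∀ (S : Subset (m Σ')) → ∣ S ∣ < q → ¬ ClusterableMinus Σ' S)

-- One direction of Davis' criterion is elementary: going once around a cycle whose
-- only negative edge is e, the cluster label stays constant along the positive edges,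
-- so both ends of e lie in one cluster and e cannot be negative unless it is deleted.
-- Conversely, label the vertices by the connected components of the undeleted
-- positive edges; this is a clustering unless some undeleted negative edge has both
-- ends in one component, and then a simple positive path between its ends closes a
-- cycle with exactly one negative edge.  Hence deleting a set S makes Σ clusterable
-- iff S meets every cycle with exactly one negative edge, and Q(Σ) = 1 says precisely
-- that such cycles exist and all pass through one common edge.
module Submission where

open import Defs
open import Data.Product using (_×_; ∃-syntax)
open import Function.Bundles using (_⇔_)

open import Data.Empty using (⊥-elim)
open import Data.Fin using (Fin; zero; suc; toℕ; fromℕ; inject₁)
open import Data.Fin.Properties
  using (toℕ-injective; toℕ-fromℕ<; toℕ-fromℕ; toℕ-inject₁; inject₁ℕ<; inject₁-injective; ≤fromℕ; fromℕ≢inject₁; any?; _≟_)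
open import Data.Fin.Subset using (Subset; _∈_; _∉_; _⊆_; ∣_∣; ⁅_⁆; inside; outside)
  renaming (⊥ to ∅)
open import Data.Fin.Subset.Properties using (_∈?_; ∣⁅x⁆∣≡1; ∣⊥∣≡0; x∈⁅x⁆; x∈⁅y⁆⇒x≡y)
open import Data.List.Base using (List; []; _∷_; allFin)
open import Data.List.Membership.Propositional using () renaming (_∈_ to _∈ₗ_)
open import Data.List.Membership.Propositional.Properties using (∈-allFin)
open import Data.List.Relation.Unary.Any using (here; there)
open import Data.Nat as ℕ using (ℕ; suc; s≤s; z≤n; _<_)
open import Data.Nat.Properties using (_<?_; <-irrefl; ≤-reflexive; n<1⇒n≡0; suc-injective)
open import Data.Product using (Σ; _,_; proj₁; proj₂; map₂)
open import Data.Product.Properties using (,-injectiveˡ; ,-injectiveʳ)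
open import Data.Sum using (_⊎_; inj₁; inj₂; [_,_]′)
open import Data.Unit using (⊤; tt)
open import Data.Vec.Base as Vec using (here; there)
open import Data.Vec.Functional using (Vector; insertAt; tail)
open import Function.Base using (id; _∘_)
open import Function.Bundles using (Equivalence; mk⇔)
open import Function.Definitions using (Injective)
open import Relation.Binary.PropositionalEquality
  using (_≡_; _≢_; refl; sym; trans; cong; subst; module ≡-Reasoning)
open import Relation.Nullary using (¬_; Dec; yes; no; contradiction)
open import Relation.Nullary.Decidable using (decidable-stable; ¬?; _×-dec_)

next-inject₁ : ∀ {k} (j : Fin k) → next (inject₁ j) ≡ suc j
next-inject₁ {k} j with toℕ (inject₁ j) <? k
... | yes p = toℕ-injective (trans (toℕ-fromℕ< (s≤s p)) (cong suc (toℕ-inject₁ j)))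
... | no ¬p = contradiction (inject₁ℕ< j) ¬p

next-fromℕ : ∀ k → next (fromℕ k) ≡ zero
next-fromℕ k with toℕ (fromℕ k) <? k
... | yes p = contradiction p (<-irrefl (toℕ-fromℕ k))
... | no _  = refl

data LastView {k} : Fin (suc k) → Set where
  last   : LastView (fromℕ k)
  inject : (j : Fin k) → LastView (inject₁ j)

lastView : ∀ {k} (i : Fin (suc k)) → LastView i
lastView {ℕ.zero} zero = last
lastView {suc k}  zero = inject zero
lastView {suc k}  (suc i) with lastView i
... | last     = last
... | inject j = inject (suc j)

_∷ʳ_ : ∀ {A : Set} {k} → Vector A k → A → Vector A (suc k)
xs ∷ʳ v = insertAt xs (fromℕ _) v

∷ʳ-last : ∀ {A : Set} {k} (xs : Vector A k) v → (xs ∷ʳ v) (fromℕ k) ≡ v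
∷ʳ-last {k = ℕ.zero} xs v = refl
∷ʳ-last {k = suc k}  xs v = ∷ʳ-last (tail xs) v

∷ʳ-inject₁ : ∀ {A : Set} {k} (xs : Vector A k) v j → (xs ∷ʳ v) (inject₁ j) ≡ xs j
∷ʳ-inject₁ {k = suc k} xs v zero    = refl
∷ʳ-inject₁ {k = suc k} xs v (suc j) = ∷ʳ-inject₁ (tail xs) v j

constant-between : ∀ {A : Set} {L} (h : Fin (suc L) → A) (a b : Fin (suc L)) →
  toℕ a ℕ.≤ toℕ b →
  (∀ j → toℕ a ℕ.≤ toℕ j → toℕ j < toℕ b → h (inject₁ j) ≡ h (suc j)) →
  h a ≡ h b
constant-between h zero zero _ _ = refl
constant-between {L = ℕ.zero} h zero (suc ()) _ _
constant-between {L = suc L} h zero (suc b) _ step =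
  trans (step zero z≤n (s≤s z≤n))
        (constant-between (h ∘ suc) zero b z≤n (λ j _ j<b → step (suc j) z≤n (s≤s j<b)))
constant-between {L = suc L} h (suc a) (suc b) (s≤s a≤b) step =
  constant-between (h ∘ suc) a b a≤b (λ j a≤j j<b → step (suc j) (s≤s a≤j) (s≤s j<b))

module _ {A : Set} {L} (h : Fin (suc L) → A) (i : Fin (suc L))
         (invariant : ∀ t → t ≢ i → h t ≡ h (next t)) where

  private
    step : ∀ j → inject₁ j ≢ i → h (inject₁ j) ≡ h (suc j)
    step j j≢i = trans (invariant (inject₁ j) j≢i) (cong h (next-inject₁ j))

  -- The other steps lead from next i once around the cycle back to i.
  next-invariant : h i ≡ h (next i)
  next-invariant with lastView i
  ... | last = begin
    h (fromℕ L)        ≡⟨ constant-between h zero (fromℕ L) z≤n (λ j _ _ → step j (fromℕ≢inject₁ ∘ sym)) ⟨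
    h zero             ≡⟨ cong h (next-fromℕ L) ⟨
    h (next (fromℕ L)) ∎
    where open ≡-Reasoning
  ... | inject k = begin
    h (inject₁ k)        ≡⟨ constant-between h zero (inject₁ k) z≤n (λ j _ j<k → step j (below j<k)) ⟨
    h zero               ≡⟨ trans (invariant (fromℕ L) fromℕ≢inject₁) (cong h (next-fromℕ L)) ⟨
    h (fromℕ L)          ≡⟨ constant-between h (suc k) (fromℕ L) (≤fromℕ (suc k)) (λ j k<j _ → step j (above k<j)) ⟨
    h (suc k)            ≡⟨ cong h (next-inject₁ k) ⟨
    h (next (inject₁ k)) ∎
    where
    open ≡-Reasoning
    below : ∀ {j} → toℕ j < toℕ (inject₁ k) → inject₁ j ≢ inject₁ k
    below {j} j<k eq = <-irrefl (trans (cong toℕ (inject₁-injective eq)) (sym (toℕ-inject₁ k))) j<k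
    above : ∀ {j} → toℕ k < toℕ j → inject₁ j ≢ inject₁ k
    above k<j eq = <-irrefl (cong toℕ (sym (inject₁-injective eq))) k<j

∣p∣≡0⇒x∉p : ∀ {k} (p : Subset k) → ∣ p ∣ ≡ 0 → ∀ x → x ∉ p
∣p∣≡0⇒x∉p (outside Vec.∷ p) ∣p∣≡0 (suc x) (there x∈p) = ∣p∣≡0⇒x∉p p ∣p∣≡0 x x∈p
∣p∣≡0⇒x∉p (inside Vec.∷ p) ()

∣p∣≡1⇒⊆⁅x⁆ : ∀ {k} (p : Subset k) → ∣ p ∣ ≡ 1 → ∃[ x ] p ⊆ ⁅ x ⁆
∣p∣≡1⇒⊆⁅x⁆ (outside Vec.∷ p) ∣p∣≡1 with ∣p∣≡1⇒⊆⁅x⁆ p ∣p∣≡1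
... | x , p⊆⁅x⁆ = suc x , λ { (there y∈p) → there (p⊆⁅x⁆ y∈p) }
∣p∣≡1⇒⊆⁅x⁆ (inside Vec.∷ p) ∣p∣≡1 = zero , λ
  { here → here
  ; (there y∈p) → contradiction y∈p (∣p∣≡0⇒x∉p p (suc-injective ∣p∣≡1) _) }

pos≢neg : pos ≢ neg
pos≢neg ()

≢neg⇒≡pos : ∀ {s} → s ≢ neg → s ≡ pos
≢neg⇒≡pos {pos} _    = refl
≢neg⇒≡pos {neg} s≢neg = contradiction refl s≢neg

≢pos⇒≡neg : ∀ {s} → s ≢ pos → s ≡ neg
≢pos⇒≡neg {pos} s≢pos = contradiction refl s≢pos
≢pos⇒≡neg {neg} _    = refl

≡neg? : ∀ s → Dec (s ≡ neg)
≡neg? pos = no λ ()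
≡neg? neg = yes refl

relabel : ℕ → ℕ → ℕ → ℕ
relabel new old k with k ℕ.≟ old
... | yes _ = new
... | no _  = k

relabel-cases : ∀ new old k → (relabel new old k ≡ new × k ≡ old) ⊎ (relabel new old k ≡ k × k ≢ old)
relabel-cases new old k with k ℕ.≟ old
... | yes k≡old = inj₁ (refl , k≡old)
... | no k≢old  = inj₂ (refl , k≢old)

module _ (Σ' : SignedGraph) where

  Joins⇒≡⇔≡-ends : ∀ e {x y} (c : Fin (n Σ') → ℕ) → Joins Σ' e x y →
    c x ≡ c y ⇔ c (proj₁ (ends Σ' e)) ≡ c (proj₂ (ends Σ' e))
  Joins⇒≡⇔≡-ends e c (inj₁ e-xy) rewrite e-xy = mk⇔ id id
  Joins⇒≡⇔≡-ends e c (inj₂ e-yx) rewrite e-yx = mk⇔ sym sym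

  Joins-endpoint : ∀ e {x y p q} → Joins Σ' e x y → Joins Σ' e p q → x ≡ p ⊎ x ≡ q
  Joins-endpoint e (inj₁ e₁) (inj₁ e₂) = inj₁ (,-injectiveˡ (trans (sym e₁) e₂))
  Joins-endpoint e (inj₁ e₁) (inj₂ e₂) = inj₂ (,-injectiveˡ (trans (sym e₁) e₂))
  Joins-endpoint e (inj₂ e₁) (inj₁ e₂) = inj₂ (,-injectiveʳ (trans (sym e₁) e₂))
  Joins-endpoint e (inj₂ e₁) (inj₂ e₂) = inj₁ (,-injectiveʳ (trans (sym e₁) e₂))

  module _ (S : Subset (m Σ')) where

    private
      V = Fin (n Σ')
      E = Fin (m Σ')

    Avoids : Cycle Σ' → Set
    Avoids C = ∀ i → edg C i ∉ S

    clusterable⇒¬avoids : ClusterableMinus Σ' S → (C : Cycle Σ') → Avoids C → ¬ ExactlyOneNegative C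
    clusterable⇒¬avoids (c , respects) C avoids (i , negative , positive) =
      different (next-invariant h i (λ t t≢i → same t (positive t t≢i)))
      where
      h : Fin (suc (len C)) → ℕ
      h t = c (vtx C t)
      same : ∀ t → sign Σ' (edg C t) ≡ pos → h t ≡ h (next t)
      same t pos-t = Equivalence.from (Joins⇒≡⇔≡-ends (edg C t) c (joins C t)) (decidable-stable (_ ℕ.≟ _)
        λ ≢-ends → pos≢neg (trans (sym pos-t) (proj₂ (respects (edg C t) (avoids t)) ≢-ends)))
      different : h i ≢ h (next i)
      different ≡-i = pos≢neg (trans
        (sym (proj₁ (respects (edg C i) (avoids i)) (Equivalence.to (Joins⇒≡⇔≡-ends (edg C i) c (joins C i)) ≡-i))) negative)

    clusterable⇒cycle-meets : ClusterableMinus Σ' S → (C : Cycle Σ') → ExactlyOneNegative C →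
      ∃[ i ] edg C i ∈ S
    clusterable⇒cycle-meets clusterable C one with any? (λ i → edg C i ∈? S)
    ... | yes meets = meets
    ... | no ¬meets = ⊥-elim (clusterable⇒¬avoids clusterable C (λ i e∈S → ¬meets (i , e∈S)) one)

    record PositiveEdge (e : E) (x y : V) : Set where
      constructor positiveEdge
      field
        undeleted  : e ∉ S
        positive   : sign Σ' e ≡ pos
        joins-ends : Joins Σ' e x y
    open PositiveEdge

    data Walk : V → V → Set where
      []   : ∀ {x} → Walk x x
      step : ∀ {x y z} e → PositiveEdge e x y → Walk y z → Walk x z

    _++ʷ_ : ∀ {x y z} → Walk x y → Walk y z → Walk x z
    []          ++ʷ w′ = w′
    step e ex w ++ʷ w′ = step e ex (w ++ʷ w′)

    _∉ᵥ_ : ∀ {y z} → V → Walk y z → Set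
    x ∉ᵥ ([] {z})            = x ≢ z
    x ∉ᵥ (step {x = y} _ _ w) = x ≢ y × x ∉ᵥ w

    IsPath : ∀ {x z} → Walk x z → Set
    IsPath []                   = ⊤
    IsPath (step {x = x} _ _ w) = x ∉ᵥ w × IsPath w

    Path : V → V → Set
    Path x z = Σ (Walk x z) IsPath

    ∉ᵥ⊎suffix : ∀ {y z} x (w : Walk y z) → IsPath w → x ∉ᵥ w ⊎ Path x z
    ∉ᵥ⊎suffix x ([] {z}) _ with x ≟ z
    ... | yes refl = inj₂ ([] , tt)
    ... | no x≢z   = inj₁ x≢z
    ∉ᵥ⊎suffix x (step {x = y} e ey w) (y∉w , w-path) with x ≟ y
    ... | yes refl = inj₂ (step e ey w , y∉w , w-path)
    ... | no x≢y   = [ (λ x∉w → inj₁ (x≢y , x∉w)) , inj₂ ]′ (∉ᵥ⊎suffix x w w-path)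

    walk⇒path : ∀ {x z} → Walk x z → Path x z
    walk⇒path [] = [] , tt
    walk⇒path (step {x = x} e ex w) with walk⇒path w
    ... | w′ , w′-path with ∉ᵥ⊎suffix x w′ w′-path
    ... | inj₁ x∉w′ = step e ex w′ , x∉w′ , w′-path
    ... | inj₂ path = path

    length : ∀ {x z} → Walk x z → ℕ
    length []           = 0
    length (step _ _ w) = suc (length w)

    vertexAt : ∀ {x z} (w : Walk x z) → Fin (suc (length w)) → V
    vertexAt ([] {x})             _       = x
    vertexAt (step {x = x} _ _ _) zero    = x
    vertexAt (step _ _ w)         (suc i) = vertexAt w i

    edgeAt : ∀ {x z} (w : Walk x z) → Fin (length w) → E
    edgeAt (step e _ _) zero    = e
    edgeAt (step _ _ w) (suc i) = edgeAt w i

    vertexAt-zero : ∀ {x z} (w : Walk x z) → vertexAt w zero ≡ x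
    vertexAt-zero []           = refl
    vertexAt-zero (step _ _ _) = refl

    vertexAt-last : ∀ {x z} (w : Walk x z) → vertexAt w (fromℕ (length w)) ≡ z
    vertexAt-last []           = refl
    vertexAt-last (step _ _ w) = vertexAt-last w

    edgeAt-positive : ∀ {x z} (w : Walk x z) j →
      PositiveEdge (edgeAt w j) (vertexAt w (inject₁ j)) (vertexAt w (suc j))
    edgeAt-positive (step {x = x} e ex w) zero    = subst (PositiveEdge e x) (sym (vertexAt-zero w)) ex
    edgeAt-positive (step _ _ w)          (suc j) = edgeAt-positive w j

    ∉ᵥ⇒vertexAt≢ : ∀ {y z x} (w : Walk y z) → x ∉ᵥ w → ∀ i → vertexAt w i ≢ x
    ∉ᵥ⇒vertexAt≢ []           x∉w         i       eq = x∉w (sym eq)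
    ∉ᵥ⇒vertexAt≢ (step _ _ w) (x≢y , _)   zero    eq = x≢y (sym eq)
    ∉ᵥ⇒vertexAt≢ (step _ _ w) (_ , x∉w)   (suc i) eq = ∉ᵥ⇒vertexAt≢ w x∉w i eq

    -- Every edge of the walk joins two of its vertices.
    ∉ᵥ⇒edgeAt≢ : ∀ {y z x x′ e} (w : Walk y z) → x ∉ᵥ w → Joins Σ' e x x′ → ∀ j → edgeAt w j ≢ e
    ∉ᵥ⇒edgeAt≢ {e = e} w x∉w e-xx′ j refl
      with Joins-endpoint e e-xx′ (joins-ends (edgeAt-positive w j))
    ... | inj₁ x≡ = ∉ᵥ⇒vertexAt≢ w x∉w (inject₁ j) (sym x≡)
    ... | inj₂ x≡ = ∉ᵥ⇒vertexAt≢ w x∉w (suc j) (sym x≡)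

    vertexAt-injective : ∀ {x z} (w : Walk x z) → IsPath w → Injective _≡_ _≡_ (vertexAt w)
    vertexAt-injective []           _          {zero}  {zero}  _  = refl
    vertexAt-injective (step _ _ w) _          {zero}  {zero}  _  = refl
    vertexAt-injective (step _ _ w) (x∉w , _)  {zero}  {suc j} eq = ⊥-elim (∉ᵥ⇒vertexAt≢ w x∉w j (sym eq))
    vertexAt-injective (step _ _ w) (x∉w , _)  {suc i} {zero}  eq = ⊥-elim (∉ᵥ⇒vertexAt≢ w x∉w i eq)
    vertexAt-injective (step _ _ w) (_ , path) {suc i} {suc j} eq = cong suc (vertexAt-injective w path eq)

    edgeAt-injective : ∀ {x z} (w : Walk x z) → IsPath w → Injective _≡_ _≡_ (edgeAt w)
    edgeAt-injective (step _ _ w)  _          {zero}  {zero}  _  = refl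
    edgeAt-injective (step _ ex w) (x∉w , _)  {zero}  {suc j} eq = ⊥-elim (∉ᵥ⇒edgeAt≢ w x∉w (joins-ends ex) j (sym eq))
    edgeAt-injective (step _ ex w) (x∉w , _)  {suc i} {zero}  eq = ⊥-elim (∉ᵥ⇒edgeAt≢ w x∉w (joins-ends ex) i eq)
    edgeAt-injective (step _ _ w)  (_ , path) {suc i} {suc j} eq = cong suc (edgeAt-injective w path eq)

    AvoidingOneNegativeCycle : Set
    AvoidingOneNegativeCycle = ∃[ C ] (Avoids C × ExactlyOneNegative C)

    closeCycle : ∀ {a b} f → f ∉ S → sign Σ' f ≡ neg → Joins Σ' f b a → Path a b → AvoidingOneNegativeCycle
    closeCycle {a} {b} f f∉S f-neg f-ba (w , w-path) =
      C , avoids , fromℕ (length w) , last-negative , others-positive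
      where
      edges : Fin (suc (length w)) → E
      edges = edgeAt w ∷ʳ f

      inject-positive : ∀ j → sign Σ' (edges (inject₁ j)) ≡ pos
      inject-positive j = trans (cong (sign Σ') (∷ʳ-inject₁ (edgeAt w) f j)) (positive (edgeAt-positive w j))

      last-negative : sign Σ' (edges (fromℕ (length w))) ≡ neg
      last-negative = trans (cong (sign Σ') (∷ʳ-last (edgeAt w) f)) f-neg

      others-positive : ∀ j → j ≢ fromℕ (length w) → sign Σ' (edges j) ≡ pos
      others-positive j j≢last with lastView j
      ... | last     = contradiction refl j≢last
      ... | inject k = inject-positive k

      edges-injective : Injective _≡_ _≡_ edges
      edges-injective {i} {j} eq with lastView i | lastView j
      ... | last     | last     = refl
      ... | last     | inject l = ⊥-elim (pos≢neg (trans (sym (inject-positive l)) (trans (cong (sign Σ') (sym eq)) last-negative)))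
      ... | inject k | last     = ⊥-elim (pos≢neg (trans (sym (inject-positive k)) (trans (cong (sign Σ') eq) last-negative)))
      ... | inject k | inject l = cong inject₁ (edgeAt-injective w w-path
        (trans (sym (∷ʳ-inject₁ (edgeAt w) f k)) (trans eq (∷ʳ-inject₁ (edgeAt w) f l))))

      edges-join : ∀ i → Joins Σ' (edges i) (vertexAt w i) (vertexAt w (next i))
      edges-join i with lastView i
      ... | last rewrite ∷ʳ-last (edgeAt w) f | next-fromℕ (length w) | vertexAt-last w | vertexAt-zero w = f-ba
      ... | inject k rewrite ∷ʳ-inject₁ (edgeAt w) f k | next-inject₁ k = joins-ends (edgeAt-positive w k)

      C : Cycle Σ'
      C = record { len = length w ; vtx = vertexAt w ; edg = edges
                 ; vtx-inj = vertexAt-injective w w-path ; edg-inj = edges-injective ; joins = edges-join }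

      avoids : Avoids C
      avoids i with lastView i
      ... | last     = subst (_∉ S) (sym (∷ʳ-last (edgeAt w) f)) f∉S
      ... | inject k = subst (_∉ S) (sym (∷ʳ-inject₁ (edgeAt w) f k)) (undeleted (edgeAt-positive w k))

    SameEnds : (V → ℕ) → E → Set
    SameEnds c e = c (proj₁ (ends Σ' e)) ≡ c (proj₂ (ends Σ' e))

    record Labelling (L : List E) : Set where
      field
        label     : V → ℕ
        connected : ∀ x y → label x ≡ label y → Walk x y
        respects  : ∀ e → e ∈ₗ L → e ∉ S → sign Σ' e ≡ pos → SameEnds label e

    skip : ∀ {e L} → ¬ (e ∉ S × sign Σ' e ≡ pos) → Labelling L → Labelling (e ∷ L)
    skip ¬kept labelling = record { Labelling labelling; respects = respects′ }
      where
      open Labelling labelling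
      respects′ : ∀ e′ → e′ ∈ₗ _ → e′ ∉ S → sign Σ' e′ ≡ pos → SameEnds label e′
      respects′ e′ (here refl)  e′∉S pos-e′ = contradiction (e′∉S , pos-e′) ¬kept
      respects′ e′ (there e′∈L) = respects e′ e′∈L

    -- The cluster of the second endpoint of e is merged into that of the first.
    merge : ∀ {e L} → e ∉ S → sign Σ' e ≡ pos → Labelling L → Labelling (e ∷ L)
    merge {e} {L} e∉S pos-e labelling = record { label = label′ ; connected = connected′ ; respects = respects′ }
      where
      open Labelling labelling
      a = proj₁ (ends Σ' e)
      b = proj₂ (ends Σ' e)

      label′ : V → ℕ
      label′ x = relabel (label a) (label b) (label x)

      label′-a : label′ a ≡ label a
      label′-a with relabel-cases (label a) (label b) (label a)
      ... | inj₁ (r , _) = r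
      ... | inj₂ (r , _) = r

      label′-b : label′ b ≡ label a
      label′-b with relabel-cases (label a) (label b) (label b)
      ... | inj₁ (r , _)    = r
      ... | inj₂ (_ , b≢b) = contradiction refl b≢b

      respects′ : ∀ e′ → e′ ∈ₗ e ∷ L → e′ ∉ S → sign Σ' e′ ≡ pos → SameEnds label′ e′
      respects′ e′ (here refl)  _ _ = trans label′-a (sym label′-b)
      respects′ e′ (there e′∈L) e′∉S pos-e′ = cong (relabel (label a) (label b)) (respects e′ e′∈L e′∉S pos-e′)

      connected′ : ∀ x y → label′ x ≡ label′ y → Walk x y
      connected′ x y eq with relabel-cases (label a) (label b) (label x) | relabel-cases (label a) (label b) (label y)
      ... | inj₁ (_ , x~b) | inj₁ (_ , y~b) = connected x y (trans x~b (sym y~b))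
      ... | inj₁ (rx , x~b) | inj₂ (ry , _) =
        connected x b x~b ++ʷ step e (positiveEdge e∉S pos-e (inj₂ refl)) (connected a y (trans (sym rx) (trans eq ry)))
      ... | inj₂ (rx , _) | inj₁ (ry , y~b) =
        connected x a (trans (sym rx) (trans eq ry)) ++ʷ step e (positiveEdge e∉S pos-e (inj₁ refl)) (connected b y (sym y~b))
      ... | inj₂ (rx , _) | inj₂ (ry , _) = connected x y (trans (sym rx) (trans eq ry))

    labelling : (L : List E) → Labelling L
    labelling [] = record
      { label = toℕ ; connected = λ x y eq → subst (Walk x) (toℕ-injective eq) [] ; respects = λ _ () }
    labelling (e ∷ L) with e ∈? S | ≡neg? (sign Σ' e)
    ... | yes e∈S | _        = skip (λ (e∉S , _) → e∉S e∈S) (labelling L)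
    ... | no e∉S  | yes neg-e = skip (λ (_ , pos-e) → pos≢neg (trans (sym pos-e) neg-e)) (labelling L)
    ... | no e∉S  | no ¬neg-e = merge e∉S (≢neg⇒≡pos ¬neg-e) (labelling L)

    open Labelling (labelling (allFin (m Σ')))

    clusterable⊎avoiding-cycle : ClusterableMinus Σ' S ⊎ AvoidingOneNegativeCycle
    clusterable⊎avoiding-cycle with any? (λ e → ¬? (e ∈? S) ×-dec ≡neg? (sign Σ' e) ×-dec (_ ℕ.≟ _))
    ... | yes (e , e∉S , neg-e , same) = inj₂ (closeCycle e e∉S neg-e (inj₂ refl) (walk⇒path (connected _ _ same)))
    ... | no ¬bad = inj₁ (label , λ e e∉S →
      (λ same → ≢neg⇒≡pos λ neg-e → ¬bad (e , e∉S , neg-e , same)) ,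
      (λ different → ≢pos⇒≡neg λ pos-e → different (respects e (∈-allFin e) e∉S pos-e)))

    cycles-meet⇒clusterable : (∀ C → ExactlyOneNegative C → ∃[ i ] edg C i ∈ S) → ClusterableMinus Σ' S
    cycles-meet⇒clusterable meet with clusterable⊎avoiding-cycle
    ... | inj₁ clusterable = clusterable
    ... | inj₂ (C , avoids , one) with meet C one
    ... | i , eᵢ∈S = contradiction eᵢ∈S (avoids i)

proposition10p3 : (Σ' : SignedGraph) →
    InclusterabilityIndexIs Σ' 1 ⇔
      ((∃[ C ] ExactlyOneNegative {Σ'} C) ×
       (∃[ e ] (∀ (C : Cycle Σ') → ExactlyOneNegative C → OnCycle e C)))
proposition10p3 Σ' = mk⇔ to from
  where
  OnEvery : Fin (m Σ') → Set
  OnEvery e = ∀ C → ExactlyOneNegative C → OnCycle e C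

  to : InclusterabilityIndexIs Σ' 1 → (∃[ C ] ExactlyOneNegative {Σ'} C) × ∃[ e ] OnEvery e
  to ((S , ∣S∣≡1 , clusterable) , minimal) with ∣p∣≡1⇒⊆⁅x⁆ S ∣S∣≡1 | clusterable⊎avoiding-cycle Σ' ∅
  ... | _       | inj₁ clusterable-∅ = ⊥-elim (minimal ∅ (s≤s (≤-reflexive (∣⊥∣≡0 (m Σ')))) clusterable-∅)
  ... | e , S⊆⁅e⁆ | inj₂ (C , _ , one) = (C , one) , e , λ C one →
    map₂ (x∈⁅y⁆⇒x≡y e ∘ S⊆⁅e⁆) (clusterable⇒cycle-meets Σ' S clusterable C one)

  from : (∃[ C ] ExactlyOneNegative {Σ'} C) × ∃[ e ] OnEvery e → InclusterabilityIndexIs Σ' 1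
  from ((C₀ , one₀) , e , on-every) = (⁅ e ⁆ , ∣⁅x⁆∣≡1 e , clusterable) , minimal
    where
    clusterable : ClusterableMinus Σ' ⁅ e ⁆
    clusterable = cycles-meet⇒clusterable Σ' ⁅ e ⁆
      λ C one → map₂ (λ { refl → x∈⁅x⁆ e }) (on-every C one)
    minimal : ∀ S → ∣ S ∣ < 1 → ¬ ClusterableMinus Σ' S
    minimal S ∣S∣<1 clusterable-S with clusterable⇒cycle-meets Σ' S clusterable-S C₀ one₀
    ... | i , eᵢ∈S = ∣p∣≡0⇒x∉p S (n<1⇒n≡0 ∣S∣<1) _ eᵢ∈S
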